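{- Let $G$ be a graph and $C$ a tropical circuit over the variables $V(G)$ computing the tropical polynomial $f$. Then $C$ outputs the weight of a maximum weight independent set of $G$ for every assignment of real weights to the variables if and only if (1) each monomial of $f$ is of the form $v_1\cdots v_l$ where $\{v_1,\dots,v_l\}$ is an independent set of $G$ (with the $v_i$ distinct), and (2) for each independent set $\{v_1,\dots,v_l\}$ of $G$ the monomial $v_1\cdots v_l$ occurs in $f$, including for the empty independent set, which corresponds to the empty product $0$.
   Context: A tropical circuit over variables $X$ is a finite directed acyclic graph whose gates have in-degree $0$ or $2$; in-degree-$0$ gates are labeled by a variable of $X$ or the constant $0$, in-degree-$2$ gates by $\max$ or $+$, and one gate is the output; with real values assigned to the variables, each gate evaluates naturally (a $\max$ gate takes the maximum of its children's values, a $+$ gate their sum) and the circuit outputs the value of the output gate. Symbolically, the circuit computes a tropical polynomial over the semiring $(\mathbb{R}\cup\{ -\infty\},\max,+)$ ($\max$ as addition, $+$ as multiplication, $0$ as multiplicative unit): each gate computes a set of monomials (finite multisets of variables): a leaf $x$ gives $\{x\}$, a leaf $0$ gives the empty monomial, a $\max$ gate the union of its children's sets, and a $+$ gate all products of one monomial from each child. The weight of an independent set is the sum of its vertices' weights (the empty set has weight $0$).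
   Formalization: The weights assigned to the variables are rational rather than real, so circuit evaluation and the weights of independent sets are computed over ℚ. -}

module Defs where

open import Data.Nat using (ℕ; zero; suc)
import Data.Nat as ℕ
open import Data.Fin using (Fin; zero; suc)
open import Data.Fin.Subset using (Subset; _∈_)
open import Data.Bool using (Bool; true; false; if_then_else_)
open import Data.Vec using (Vec; []; _∷_; lookup; replicate; zipWith; tabulate; map)
open import Data.Rational using (ℚ; 0ℚ; _+_; _⊔_; _≤_)
open import Data.Product using (Σ; ∃; _×_; _,_)
open import Data.Sum using (_⊎_)
open import Relation.Binary.PropositionalEquality using (_≡_)
open import Relation.Nullary using (¬_; does)
open import Data.Fin using (_≟_)
open import Level using (Level)

record Graph (n : ℕ) : Set₁ where
  field
    Adj     : Fin n → Fin n → Set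
    sym     : ∀ {u v} → Adj u v → Adj v u
    irrefl  : ∀ {u} → ¬ Adj u u
open Graph public

Independent : ∀ {n} → Graph n → Subset n → Set
Independent G S = ∀ u v → u ∈ S → v ∈ S → ¬ Adj G u v

weight : ∀ {n} → (Fin n → ℚ) → Subset n → ℚ
weight w []           = 0ℚ
weight w (true  ∷ S)  = w zero + weight (λ i → w (suc i)) S
weight w (false ∷ S)  = weight (λ i → w (suc i)) S

IsMaxIndWeight : ∀ {n} → Graph n → (Fin n → ℚ) → ℚ → Set
IsMaxIndWeight G w r =
  (Σ (Subset _) λ S → Independent G S × weight w S ≡ r) ×
  (∀ T → Independent G T → weight w T ≤ r)

-- Tropical circuits over variables Fin n, as DAGs in topological order.
-- Gate k is a gate whose children are among the k previously built gates.

data Gate (n k : ℕ) : Set where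
  var   : Fin n → Gate n k
  const0 : Gate n k
  max   : Fin k → Fin k → Gate n k
  plus  : Fin k → Fin k → Gate n k

data Circuit (n : ℕ) : ℕ → Set where
  []  : Circuit n 0
  _▷_ : ∀ {k} → Circuit n k → Gate n k → Circuit n (suc k)

snoc : ∀ {a} {A : Set a} {k} → Vec A k → A → Vec A (suc k)
snoc []       a = a ∷ []
snoc (x ∷ xs) a = x ∷ snoc xs a

evalGate : ∀ {n k} → (Fin n → ℚ) → Vec ℚ k → Gate n k → ℚ
evalGate w vs (var x)    = w x
evalGate w vs const0     = 0ℚ
evalGate w vs (max i j)  = lookup vs i ⊔ lookup vs j
evalGate w vs (plus i j) = lookup vs i + lookup vs j

evalAll : ∀ {n k} → Circuit n k → (Fin n → ℚ) → Vec ℚ k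
evalAll []      w = []
evalAll (C ▷ g) w = let vs = evalAll C w in snoc vs (evalGate w vs g)

eval : ∀ {n k} → Circuit n k → Fin k → (Fin n → ℚ) → ℚ
eval C o w = lookup (evalAll C w) o

-- Symbolic semantics: monomials are finite multisets of variables,
-- represented by their multiplicity vectors; a tropical polynomial is a
-- set of monomials (a predicate).

Monomial : ℕ → Set
Monomial n = Vec ℕ n

Poly : ℕ → Set₁
Poly n = Monomial n → Set

varMono : ∀ {n} → Fin n → Monomial n
varMono x = tabulate (λ i → if does (i ≟ x) then 1 else 0)

oneMono : ∀ {n} → Monomial n
oneMono = replicate _ 0

mulMono : ∀ {n} → Monomial n → Monomial n → Monomial n
mulMono = zipWith ℕ._+_

polyGate : ∀ {n k} → Vec (Poly n) k → Gate n k → Poly n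
polyGate ps (var x)    m = m ≡ varMono x
polyGate ps const0     m = m ≡ oneMono
polyGate ps (max i j)  m = lookup ps i m ⊎ lookup ps j m
polyGate ps (plus i j) m =
  Σ (Monomial _) λ m₁ → Σ (Monomial _) λ m₂ →
    lookup ps i m₁ × lookup ps j m₂ × m ≡ mulMono m₁ m₂

polyAll : ∀ {n k} → Circuit n k → Vec (Poly n) k
polyAll []      = []
polyAll (C ▷ g) = let ps = polyAll C in snoc ps (polyGate ps g)

poly : ∀ {n k} → Circuit n k → Fin k → Poly n
poly C o = lookup (polyAll C) o

setMono : ∀ {n} → Subset n → Monomial n
setMono S = map (λ b → if b then 1 else 0) S

{-# OPTIONS --safe #-}

-- Under any weights, every gate evaluates to the largest value of one of its monomials, so
-- (1) and (2) make the output the largest weight of an independent set.  Conversely, weight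
-- the vertices +1 on the support of a monomial m and −1 off it: then every multilinear
-- monomial setMono T is worth at most m, and as much only if m = setMono T.  Since the output
-- value is at least that of m and is the weight of some independent T, m = setMono T.  For an
-- independent S, the weights of setMono S then force the monomial attaining the output value
-- to be setMono S.

module Submission where

open import Defs
open import Data.Nat using (ℕ)
open import Data.Fin using (Fin)
open import Data.Fin.Subset using (Subset)
open import Data.Rational using (ℚ)
open import Data.Product using (Σ; _×_)
open import Function.Bundles using (_⇔_)
open import Relation.Binary.PropositionalEquality using (_≡_)

open import Data.Bool using (true; false; if_then_else_)
open import Data.Empty using (⊥-elim)
open import Data.Fin using (zero; suc; punchIn; _≟_)
open import Data.Fin.Properties using (punchInᵢ≢i)
open import Data.Nat as ℕ using (zero; suc)
open import Data.Product using (∃; _,_; proj₁; proj₂; <_,_>; uncurry)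
open import Data.Rational using (0ℚ; 1ℚ; -_; _+_; _⊔_; _≤_; _<_; _≤?_)
open import Data.Rational.Properties
  using ( ≤-refl; ≤-trans; ≤-antisym; <⇒≤; ≮⇒≥; <-irrefl; <-≤-trans; positive⁻¹
        ; +-mono-≤; +-mono-<-≤; +-mono-≤-<; +-monoʳ-≤; +-monoʳ-<; +-identityˡ; +-identityʳ
        ; p≤p⊔q; p≤q⊔p; ⊔-sel; +-0-monoid; +-0-commutativeMonoid; module ≤-Reasoning )
open import Algebra.Properties.CommutativeMonoid.Sum +-0-commutativeMonoid
  using (sum; sum-cong-≗; sum-remove; sum-replicate-zero; ∑-distrib-+)
open import Algebra.Properties.Monoid.Mult +-0-monoid
  using (×-homo-1; ×-homo-+) renaming (_×_ to _·_)
open import Data.Sum using (_⊎_; inj₁; inj₂)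
open import Data.Vec using (Vec; []; _∷_; lookup; zipWith)
open import Data.Vec.Functional using (Vector; removeAt)
open import Data.Vec.Properties
  using (lookup-map; lookup-zipWith; lookup-replicate; lookup∘tabulate; tabulate∘lookup; tabulate-cong)
open import Data.Vec.Relation.Binary.Pointwise.Inductive as Pointwise using (Pointwise; []; _∷_)
open import Function using (_∘_)
open import Function.Bundles using (mk⇔)
open import Relation.Nullary using (does)
open import Relation.Nullary.Decidable using (dec-true; dec-false; from-yes)
open import Relation.Binary.PropositionalEquality as ≡
  using (_≗_; refl; trans; cong; cong₂; subst; module ≡-Reasoning)

private
  variable
    n : ℕ

×-nonNeg : ∀ c {q} → 0ℚ ≤ q → 0ℚ ≤ c · q
×-nonNeg zero    _   = ≤-refl
×-nonNeg (suc c) 0≤q = +-mono-≤ 0≤q (×-nonNeg c 0≤q)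

×-pos : ∀ c {q} → 0ℚ < q → 0ℚ < suc c · q
×-pos c 0<q = +-mono-<-≤ 0<q (×-nonNeg c (<⇒≤ 0<q))

sum-mono-≤ : {f g : Vector ℚ n} → (∀ i → f i ≤ g i) → sum f ≤ sum g
sum-mono-≤ {zero}  _   = ≤-refl
sum-mono-≤ {suc n} f≤g = +-mono-≤ (f≤g zero) (sum-mono-≤ (f≤g ∘ suc))

sum-mono-< : {f g : Vector ℚ n} → (∀ i → f i ≤ g i) → ∀ i → f i < g i → sum f < sum g
sum-mono-< f≤g zero    fi<gi = +-mono-<-≤ fi<gi (sum-mono-≤ (f≤g ∘ suc))
sum-mono-< f≤g (suc i) fi<gi = +-mono-≤-< (f≤g zero) (sum-mono-< (f≤g ∘ suc) i fi<gi)

sum-mono-≤-rigid : {f g : Vector ℚ n} → (∀ i → f i ≤ g i) → sum g ≤ sum f → f ≗ g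
sum-mono-≤-rigid f≤g Σg≤Σf i =
  ≤-antisym (f≤g i) (≮⇒≥ (λ fi<gi → <-irrefl refl (<-≤-trans (sum-mono-< f≤g i fi<gi) Σg≤Σf)))

evalMono : (Fin n → ℚ) → Monomial n → ℚ
evalMono w m = sum (λ i → lookup m i · w i)

evalMono-mulMono : ∀ (w : Fin n → ℚ) m₁ m₂ →
                   evalMono w (mulMono m₁ m₂) ≡ evalMono w m₁ + evalMono w m₂
evalMono-mulMono w m₁ m₂ = begin
  sum (λ i → lookup (zipWith ℕ._+_ m₁ m₂) i · w i)      ≡⟨ sum-cong-≗ distrib ⟩
  sum (λ i → lookup m₁ i · w i + lookup m₂ i · w i)     ≡⟨ ∑-distrib-+ (λ i → lookup m₁ i · w i) (λ i → lookup m₂ i · w i) ⟩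
  evalMono w m₁ + evalMono w m₂                         ∎
  where
  open ≡-Reasoning
  distrib : ∀ i → lookup (zipWith ℕ._+_ m₁ m₂) i · w i ≡ lookup m₁ i · w i + lookup m₂ i · w i
  distrib i = trans (cong (_· w i) (lookup-zipWith ℕ._+_ i m₁ m₂)) (×-homo-+ (w i) (lookup m₁ i) (lookup m₂ i))

evalMono-oneMono : ∀ (w : Fin n → ℚ) → evalMono w oneMono ≡ 0ℚ
evalMono-oneMono {n} w =
  trans (sum-cong-≗ (λ i → cong (_· w i) (lookup-replicate i 0))) (sum-replicate-zero n)

evalMono-varMono : ∀ (w : Fin n → ℚ) x → evalMono w (varMono x) ≡ w x
evalMono-varMono {suc n} w x = begin
  sum t                       ≡⟨ sum-remove {i = x} t ⟩
  t x + sum (removeAt t x)    ≡⟨ cong₂ _+_ at-x (trans (sum-cong-≗ off-x) (sum-replicate-zero n)) ⟩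
  w x + 0ℚ                    ≡⟨ +-identityʳ (w x) ⟩
  w x                         ∎
  where
  open ≡-Reasoning
  t : Vector ℚ (suc n)
  t i = lookup (varMono x) i · w i
  coefficient : ∀ i → lookup (varMono x) i ≡ (if does (i ≟ x) then 1 else 0)
  coefficient = lookup∘tabulate _
  at-x : t x ≡ w x
  at-x rewrite coefficient x | dec-true (x ≟ x) refl = ×-homo-1 (w x)
  off-x : ∀ j → removeAt t x j ≡ 0ℚ
  off-x j rewrite coefficient (punchIn x j) | dec-false (punchIn x j ≟ x) (punchInᵢ≢i x j) = refl

evalMono-setMono : ∀ (w : Fin n → ℚ) S → evalMono w (setMono S) ≡ weight w S
evalMono-setMono w []          = refl
evalMono-setMono w (true ∷ S)  = cong₂ _+_ (+-identityʳ (w zero)) (evalMono-setMono (w ∘ suc) S)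
evalMono-setMono w (false ∷ S) = trans (+-identityˡ _) (evalMono-setMono (w ∘ suc) S)

_∪_ : Poly n → Poly n → Poly n
(p ∪ q) m = p m ⊎ q m

_⊗_ : Poly n → Poly n → Poly n
(p ⊗ q) m = Σ (Monomial _) λ m₁ → Σ (Monomial _) λ m₂ → p m₁ × q m₂ × m ≡ mulMono m₁ m₂

IsMaxMonoValue : (Fin n → ℚ) → Poly n → ℚ → Set
IsMaxMonoValue w p v = (∀ m → p m → evalMono w m ≤ v) × (∃ λ m → p m × evalMono w m ≡ v)

isMax-singleton : ∀ (w : Fin n → ℚ) m → IsMaxMonoValue w (_≡ m) (evalMono w m)
isMax-singleton w m = (λ { _ refl → ≤-refl }) , m , refl , refl

isMax-∪ : ∀ {w : Fin n → ℚ} {p q v u} →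
          IsMaxMonoValue w p v → IsMaxMonoValue w q u → IsMaxMonoValue w (p ∪ q) (v ⊔ u)
isMax-∪ {w = w} {p} {q} {v} {u} (p≤v , mp , pmp , mp≡v) (q≤u , mq , qmq , mq≡u) =
  bounded , attained (⊔-sel v u)
  where
  bounded : ∀ m → (p ∪ q) m → evalMono w m ≤ v ⊔ u
  bounded m (inj₁ pm) = ≤-trans (p≤v m pm) (p≤p⊔q v u)
  bounded m (inj₂ qm) = ≤-trans (q≤u m qm) (p≤q⊔p v u)
  attained : v ⊔ u ≡ v ⊎ v ⊔ u ≡ u → ∃ λ m → (p ∪ q) m × evalMono w m ≡ v ⊔ u
  attained (inj₁ v⊔u≡v) = mp , inj₁ pmp , trans mp≡v (≡.sym v⊔u≡v)
  attained (inj₂ v⊔u≡u) = mq , inj₂ qmq , trans mq≡u (≡.sym v⊔u≡u)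

isMax-⊗ : ∀ {w : Fin n → ℚ} {p q v u} →
          IsMaxMonoValue w p v → IsMaxMonoValue w q u → IsMaxMonoValue w (p ⊗ q) (v + u)
isMax-⊗ {w = w} {p} {q} {v} {u} (p≤v , mp , pmp , mp≡v) (q≤u , mq , qmq , mq≡u) = bounded , attained
  where
  bounded : ∀ m → (p ⊗ q) m → evalMono w m ≤ v + u
  bounded _ (m₁ , m₂ , pm₁ , qm₂ , refl) =
    subst (_≤ v + u) (≡.sym (evalMono-mulMono w m₁ m₂)) (+-mono-≤ (p≤v m₁ pm₁) (q≤u m₂ qm₂))
  attained : ∃ λ m → (p ⊗ q) m × evalMono w m ≡ v + u
  attained = mulMono mp mq , (mp , mq , pmp , qmq , refl) ,
             trans (evalMono-mulMono w mp mq) (cong₂ _+_ mp≡v mq≡u)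

isMax-evalGate : ∀ {k} {w : Fin n → ℚ} {ps : Vec (Poly n) k} {vs} →
                 Pointwise (IsMaxMonoValue w) ps vs →
                 ∀ g → IsMaxMonoValue w (polyGate ps g) (evalGate w vs g)
isMax-evalGate {w = w} _ (var x)    =
  subst (IsMaxMonoValue w (_≡ varMono x)) (evalMono-varMono w x) (isMax-singleton w (varMono x))
isMax-evalGate {w = w} _ const0     =
  subst (IsMaxMonoValue w (_≡ oneMono)) (evalMono-oneMono w) (isMax-singleton w oneMono)
isMax-evalGate ps~vs    (max i j)  = isMax-∪ (Pointwise.lookup ps~vs i) (Pointwise.lookup ps~vs j)
isMax-evalGate ps~vs    (plus i j) = isMax-⊗ (Pointwise.lookup ps~vs i) (Pointwise.lookup ps~vs j)

snoc⁺ : ∀ {a b ℓ} {A : Set a} {B : Set b} {R : A → B → Set ℓ} {k} {xs : Vec A k} {ys : Vec B k} {x y} →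
        Pointwise R xs ys → R x y → Pointwise R (snoc xs x) (snoc ys y)
snoc⁺ []              xRy = xRy ∷ []
snoc⁺ (x′Ry′ ∷ xsRys) xRy = x′Ry′ ∷ snoc⁺ xsRys xRy

isMax-polyAll : ∀ {k} (C : Circuit n k) w → Pointwise (IsMaxMonoValue w) (polyAll C) (evalAll C w)
isMax-polyAll []      w = []
isMax-polyAll (C ▷ g) w = snoc⁺ ih (isMax-evalGate ih g)
  where ih = isMax-polyAll C w

isMax-poly : ∀ {k} (C : Circuit n k) o w → IsMaxMonoValue w (poly C o) (eval C o w)
isMax-poly C o w = Pointwise.lookup (isMax-polyAll C w) o

occurrenceSign : ℕ → ℚ
occurrenceSign zero    = - 1ℚ
occurrenceSign (suc _) = 1ℚ

supportSign : Monomial n → Fin n → ℚ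
supportSign m i = occurrenceSign (lookup m i)

occurrenceSign-term-≤ : ∀ b c → (if b then 1 else 0) · occurrenceSign c ≤ c · occurrenceSign c
occurrenceSign-term-≤ false zero    = ≤-refl
occurrenceSign-term-≤ true  zero    = from-yes (- 1ℚ + 0ℚ ≤? 0ℚ)
occurrenceSign-term-≤ false (suc c) = <⇒≤ (×-pos c (positive⁻¹ 1ℚ))
occurrenceSign-term-≤ true  (suc c) = +-monoʳ-≤ 1ℚ (×-nonNeg c (<⇒≤ (positive⁻¹ 1ℚ)))

occurrenceSign-term-≡ : ∀ b c → (if b then 1 else 0) · occurrenceSign c ≡ c · occurrenceSign c →
                        c ≡ (if b then 1 else 0)
occurrenceSign-term-≡ false zero          _  = refl
occurrenceSign-term-≡ true  zero          ()
occurrenceSign-term-≡ false (suc c)       eq = ⊥-elim (<-irrefl eq (×-pos c (positive⁻¹ 1ℚ)))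
occurrenceSign-term-≡ true  (suc zero)    _  = refl
occurrenceSign-term-≡ true  (suc (suc c)) eq = ⊥-elim (<-irrefl eq (+-monoʳ-< 1ℚ (×-pos c (positive⁻¹ 1ℚ))))

lookup-extensional : ∀ {a} {A : Set a} {xs ys : Vec A n} → (∀ i → lookup xs i ≡ lookup ys i) → xs ≡ ys
lookup-extensional {xs = xs} {ys} eq =
  trans (≡.sym (tabulate∘lookup xs)) (trans (tabulate-cong eq) (tabulate∘lookup ys))

evalMono-supportSign-rigid : ∀ (m : Monomial n) T →
                             evalMono (supportSign m) m ≤ evalMono (supportSign m) (setMono T) →
                             m ≡ setMono T
evalMono-supportSign-rigid m T m≤T = lookup-extensional coordinate
  where
  term-≤ : ∀ i → lookup (setMono T) i · supportSign m i ≤ lookup m i · supportSign m i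
  term-≤ i rewrite lookup-map i (λ b → if b then 1 else 0) T = occurrenceSign-term-≤ (lookup T i) (lookup m i)
  coordinate : ∀ i → lookup m i ≡ lookup (setMono T) i
  coordinate i with sum-mono-≤-rigid term-≤ m≤T i
  ... | term≡ rewrite lookup-map i (λ b → if b then 1 else 0) T =
    occurrenceSign-term-≡ (lookup T i) (lookup m i) term≡

module Characterisation {k} (G : Graph n) (C : Circuit n k) (o : Fin k) where

  open ≤-Reasoning

  ComputesMaxIndWeight : Set
  ComputesMaxIndWeight = (w : Fin n → ℚ) → IsMaxIndWeight G w (eval C o w)

  MonomialsAreIndependentSets : Set
  MonomialsAreIndependentSets =
    (m : Monomial n) → poly C o m → Σ (Subset n) λ S → Independent G S × m ≡ setMono S

  IndependentSetsAreMonomials : Set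
  IndependentSetsAreMonomials = (S : Subset n) → Independent G S → poly C o (setMono S)

  computes⇒monomialsAreIndependentSets : ComputesMaxIndWeight → MonomialsAreIndependentSets
  computes⇒monomialsAreIndependentSets computes m pm with computes (supportSign m)
  ... | (T , indT , weight≡eval) , _ = T , indT , evalMono-supportSign-rigid m T (begin
    evalMono w m               ≤⟨ proj₁ (isMax-poly C o w) m pm ⟩
    eval C o w                 ≡⟨ ≡.sym weight≡eval ⟩
    weight w T                 ≡⟨ ≡.sym (evalMono-setMono w T) ⟩
    evalMono w (setMono T)     ∎)
    where w = supportSign m

  computes⇒independentSetsAreMonomials : ComputesMaxIndWeight → IndependentSetsAreMonomials
  computes⇒independentSetsAreMonomials computes S indS
    with proj₂ (isMax-poly C o (supportSign (setMono S)))
  ... | m , pm , value≡eval with computes⇒monomialsAreIndependentSets computes m pm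
  ...   | T , _ , refl = subst (poly C o) (≡.sym S≡T) pm
    where
    w = supportSign (setMono S)
    S≡T : setMono S ≡ setMono T
    S≡T = evalMono-supportSign-rigid (setMono S) T (begin
      evalMono w (setMono S)   ≡⟨ evalMono-setMono w S ⟩
      weight w S               ≤⟨ proj₂ (computes w) S indS ⟩
      eval C o w               ≡⟨ ≡.sym value≡eval ⟩
      evalMono w (setMono T)   ∎)

  conditions⇒computes : MonomialsAreIndependentSets → IndependentSetsAreMonomials → ComputesMaxIndWeight
  conditions⇒computes independent present w with proj₂ (isMax-poly C o w)
  ... | m , pm , value≡eval with independent m pm
  ...   | S , indS , refl =
    (S , indS , trans (≡.sym (evalMono-setMono w S)) value≡eval) ,
    λ T indT → subst (_≤ eval C o w) (evalMono-setMono w T)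
                     (proj₁ (isMax-poly C o w) (setMono T) (present T indT))

lemma7 : (n : ℕ) (G : Graph n) (k : ℕ) (C : Circuit n k) (o : Fin k) →
         ((w : Fin n → ℚ) → IsMaxIndWeight G w (eval C o w))
         ⇔ (((m : Monomial n) → poly C o m →
               Σ (Subset n) λ S → Independent G S × m ≡ setMono S)
            × ((S : Subset n) → Independent G S → poly C o (setMono S)))
lemma7 n G k C o =
  mk⇔ < computes⇒monomialsAreIndependentSets , computes⇒independentSetsAreMonomials >
      (uncurry conditions⇒computes)
  where open Characterisation G C o
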